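{- Let $G$ and $H$ be two nontrivial connected graphs. Then $hn_{cc}(G\circ H)=2$.
   Context: All graphs are finite, simple and undirected. Cycle convexity on a graph $G$: for $S\subseteq V(G)$, the cycle interval $\langle S\rangle$ is $S$ together with every vertex $w\in V(G)$ that lies on a cycle of the induced subgraph $G[S\cup\{w\}]$ passing through $w$. $S$ is (cycle) convex if $\langle S\rangle=S$. The cycle convex hull $\langle S\rangle_C$ is the smallest convex set containing $S$. $S$ is a hull set if $\langle S\rangle_C=V(G)$, and $hn_{cc}(G)$ is the minimum cardinality of a hull set of $G$. The lexicographic product $G\circ H$ has vertex set $V(G)\times V(H)$, with $(g_1,h_1)\sim(g_2,h_2)$ iff $g_1\sim g_2$ in $G$, or ($g_1=g_2$ and $h_1\sim h_2$ in $H$). A graph is nontrivial if it has at least two vertices. -}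

module Defs where

open import Data.Nat using (ℕ; _≤_)
open import Data.Fin using (Fin)
open import Data.Product using (Σ; _×_; _,_; ∃)
open import Data.Sum using (_⊎_; inj₁; inj₂)
open import Data.Empty using (⊥)
open import Data.Unit using (⊤)
open import Data.List using (List; []; _∷_; length; last)
open import Data.List.Relation.Unary.All using (All)
open import Data.List.Relation.Unary.Unique.Propositional using (Unique)
open import Data.List.Membership.Propositional using (_∈_)
open import Data.Maybe using (Maybe; just; nothing)
open import Relation.Binary.PropositionalEquality using (_≡_; refl)
open import Relation.Nullary using (¬_)

record Graph (V : Set) : Set₁ where
  field
    Adj   : V → V → Set
    adj-sym : ∀ {u v} → Adj u v → Adj v u
    irrefl : ∀ {v} → ¬ Adj v v
open Graph public

data Reach {V : Set} (G : Graph V) : V → V → Set where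
  here : ∀ {v} → Reach G v v
  step : ∀ {u v w} → Adj G u v → Reach G v w → Reach G u w

Connected : {V : Set} → Graph V → Set
Connected G = ∀ u v → Reach G u v

lexProduct : {A B : Set} → Graph A → Graph B → Graph (A × B)
lexProduct {A} {B} G H = record { Adj = adj ; adj-sym = s ; irrefl = ir }
  where
  adj : A × B → A × B → Set
  adj (g₁ , h₁) (g₂ , h₂) = Adj G g₁ g₂ ⊎ (g₁ ≡ g₂ × Adj H h₁ h₂)
  s : ∀ {u v} → adj u v → adj v u
  s (inj₁ a) = inj₁ (Graph.adj-sym G a)
  s (inj₂ (refl , a)) = inj₂ (refl , Graph.adj-sym H a)
  ir : ∀ {v} → ¬ adj v v
  ir (inj₁ a) = Graph.irrefl G a
  ir (inj₂ (_ , a)) = Graph.irrefl H a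

Chain : {V : Set} → Graph V → List V → Set
Chain G [] = ⊤
Chain G (x ∷ []) = ⊤
Chain G (x ∷ y ∷ xs) = Adj G x y × Chain G (y ∷ xs)

LastAdj : {V : Set} → Graph V → List V → V → Set
LastAdj G vs w with last vs
... | just x = Adj G x w
... | nothing = ⊥

-- w lies on a cycle of the induced subgraph G[S ∪ {w}] passing through w:
-- a cycle w, v₁, …, vₖ, w with k ≥ 2, all vertices distinct, each vᵢ ∈ S ∪ {w}.
CycleThrough : {V : Set} → Graph V → (V → Set) → V → Set
CycleThrough {V} G S w =
  Σ (List V) λ vs →
    (2 ≤ length vs) × Unique (w ∷ vs) ×
    All (λ v → S v ⊎ v ≡ w) vs ×
    Chain G (w ∷ vs) × LastAdj G vs w

Interval : {V : Set} → Graph V → (V → Set) → V → Set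
Interval G S w = S w ⊎ CycleThrough G S w

Convex : {V : Set} → Graph V → (V → Set) → Set
Convex {V} G C = ∀ (w : V) → Interval G C w → C w

Hull : {V : Set} → Graph V → (V → Set) → V → Set₁
Hull {V} G S v = (C : V → Set) → Convex G C → (∀ u → S u → C u) → C v

-- A finite vertex set given as a duplicate-free list; its cardinality is its length.
IsHullSet : {V : Set} → Graph V → List V → Set₁
IsHullSet G S = Unique S × (∀ v → Hull G (λ u → u ∈ S) v)

HullNumber : {V : Set} → Graph V → ℕ → Set₁
HullNumber {V} G k =
  (Σ (List V) λ S → IsHullSet G S × length S ≡ k) ×
  (∀ (S : List V) → IsHullSet G S → k ≤ length S)

{-# OPTIONS --safe #-}
module Submission where

-- If g₁g₂ is an edge of G and h₁h₂ an edge of H, then {(g₁,h₁), (g₁,h₂)} is a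
-- hull set of G ∘ H: each (g,h) with g adjacent to g₁ closes a triangle with
-- the two seeds, and once a whole fibre {u} × V(H) is in a convex set, so is
-- every fibre over a neighbour of u; connectivity of G spreads this to all of
-- G ∘ H.  Conversely a cycle needs two vertices of S besides w, so sets with
-- at most one element are convex and cannot span a graph with two vertices.

open import Defs
open import Data.Nat using (ℕ; _≤_; _≤?_; z≤n; s≤s)
open import Data.Nat.Properties using (≰⇒>)
open import Data.Fin using (Fin; zero; suc)
open import Data.Product using (Σ; _×_; _,_)
open import Data.Sum using (_⊎_; inj₁; inj₂)
open import Data.Empty using (⊥-elim)
open import Data.Unit using (tt)
open import Data.List using (List; []; _∷_; length)
open import Data.List.Relation.Unary.All using ([]; _∷_)
open import Data.List.Relation.Unary.AllPairs using ([]; _∷_)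
open import Data.List.Relation.Unary.Any using (here; there)
open import Data.List.Relation.Unary.Unique.Propositional using (Unique)
open import Data.List.Membership.Propositional using (_∈_)
open import Relation.Binary.PropositionalEquality using (_≡_; _≢_; refl; sym; trans)
open import Relation.Nullary using (yes; no)

module _ {V : Set} (G : Graph V) where

  adj⇒≢ : ∀ {x y} → Adj G x y → x ≢ y
  adj⇒≢ xy refl = irrefl G xy

  reach⇒neighbour : ∀ {x y} → Reach G x y → x ≢ y → Σ V (Adj G x)
  reach⇒neighbour here                x≢x = ⊥-elim (x≢x refl)
  reach⇒neighbour (step {v = v} xv _) _ = v , xv

  convex-triangle-closed : ∀ {C : V → Set} → Convex G C →
    ∀ {w a b} → C a → C b → Adj G w a → Adj G a b → Adj G b w → C w
  convex-triangle-closed convex {w} {a} {b} a∈C b∈C wa ab bw =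
    convex w (inj₂ (a ∷ b ∷ [] , s≤s (s≤s z≤n) , distinct ,
      (inj₁ a∈C ∷ inj₁ b∈C ∷ []) , (wa , ab , tt) , bw))
    where
    distinct : Unique (w ∷ a ∷ b ∷ [])
    distinct = (adj⇒≢ wa ∷ (λ w≡b → adj⇒≢ bw (sym w≡b)) ∷ []) ∷ (adj⇒≢ ab ∷ []) ∷ [] ∷ []

  cycleThrough⇒two-members : ∀ {S : V → Set} {w} → CycleThrough G S w →
    Σ V λ a → Σ V λ b → a ≢ b × S a × S b
  cycleThrough⇒two-members ([] , () , _)
  cycleThrough⇒two-members (_ ∷ [] , s≤s () , _)
  cycleThrough⇒two-members {S} {w}
    (a ∷ b ∷ _ , _ , ((w≢a ∷ w≢b ∷ _) ∷ (a≢b ∷ _) ∷ _) , (a∈S+w ∷ b∈S+w ∷ _) , _) =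
    a , b , a≢b , member w≢a a∈S+w , member w≢b b∈S+w
    where
    member : ∀ {v} → w ≢ v → S v ⊎ v ≡ w → S v
    member _   (inj₁ v∈S) = v∈S
    member w≢v (inj₂ v≡w) = ⊥-elim (w≢v (sym v≡w))

  at-most-one-convex : ∀ {S : V → Set} → (∀ {a b} → S a → S b → a ≡ b) → Convex G S
  at-most-one-convex _      w (inj₁ w∈S)  = w∈S
  at-most-one-convex unique w (inj₂ cycle) =
    let _ , _ , a≢b , a∈S , b∈S = cycleThrough⇒two-members cycle
    in  ⊥-elim (a≢b (unique a∈S b∈S))

  short-list-∈-unique : ∀ (S : List V) → length S ≤ 1 → ∀ {a b} → a ∈ S → b ∈ S → a ≡ b
  short-list-∈-unique (_ ∷ [])    _         (here a≡s) (here b≡s) = trans a≡s (sym b≡s)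
  short-list-∈-unique (_ ∷ [])    _         (there ())  _
  short-list-∈-unique (_ ∷ [])    _         _          (there ())
  short-list-∈-unique (_ ∷ _ ∷ _) (s≤s ()) _          _

  hullSet-length≥2 : ∀ {x y} → x ≢ y → ∀ {S} → IsHullSet G S → 2 ≤ length S
  hullSet-length≥2 {x} {y} x≢y {S} (_ , spans) with length S ≤? 1
  ... | no  length≰1 = ≰⇒> length≰1
  ... | yes length≤1 = ⊥-elim (x≢y (same (∈S x) (∈S y)))
    where
    same : ∀ {a b} → a ∈ S → b ∈ S → a ≡ b
    same = short-list-∈-unique S length≤1
    ∈S : ∀ v → v ∈ S
    ∈S v = spans v (_∈ S) (at-most-one-convex same) (λ _ v∈S → v∈S)

edge-of-connected : ∀ {m} (G : Graph (Fin m)) → 2 ≤ m → Connected G →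
  Σ (Fin m) λ x → Σ (Fin m) (Adj G x)
edge-of-connected G (s≤s (s≤s z≤n)) connected =
  zero , reach⇒neighbour G (connected zero (suc zero)) λ ()

module _ {A B : Set} (G : Graph A) (H : Graph B) where

  private
    G∘H : Graph (A × B)
    G∘H = lexProduct G H

  module _ {C : A × B → Set} (convex : Convex G∘H C) {h₁ h₂} (h₁h₂ : Adj H h₁ h₂) where

    fibre-from-neighbour : ∀ {g u} → Adj G g u → C (u , h₁) → C (u , h₂) → ∀ h → C (g , h)
    fibre-from-neighbour gu uh₁∈C uh₂∈C h =
      convex-triangle-closed G∘H convex uh₁∈C uh₂∈C
        (inj₁ gu) (inj₂ (refl , h₁h₂)) (inj₁ (adj-sym G gu))

    fibre-along-walk : ∀ {g u} → Reach G g u → (∀ h → C (u , h)) → ∀ h → C (g , h)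
    fibre-along-walk here                   fibre-u = fibre-u
    fibre-along-walk (step {v = v} gv walk) fibre-u =
      fibre-from-neighbour gv (fibre-v h₁) (fibre-v h₂)
      where
      fibre-v : ∀ h → C (v , h)
      fibre-v = fibre-along-walk walk fibre-u

  lex-edge-hullSet : Connected G → ∀ {g₁ g₂ h₁ h₂} → Adj G g₁ g₂ → Adj H h₁ h₂ →
    IsHullSet G∘H ((g₁ , h₁) ∷ (g₁ , h₂) ∷ [])
  lex-edge-hullSet connected {g₁} {g₂} {h₁} {h₂} g₁g₂ h₁h₂ =
    ((adj⇒≢ G∘H (inj₂ (refl , h₁h₂)) ∷ []) ∷ [] ∷ []) , spans
    where
    spans : ∀ v → Hull G∘H (_∈ ((g₁ , h₁) ∷ (g₁ , h₂) ∷ [])) v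
    spans (g , h) C convex seeds⊆C =
      fibre-along-walk convex h₁h₂ (connected g g₂) fibre-g₂ h
      where
      fibre-g₂ : ∀ h → C (g₂ , h)
      fibre-g₂ = fibre-from-neighbour convex h₁h₂ (adj-sym G g₁g₂)
                   (seeds⊆C _ (here refl)) (seeds⊆C _ (there (here refl)))

mainTheorem2 : (m n : ℕ) (G : Graph (Fin m)) (H : Graph (Fin n)) →
    2 ≤ m → 2 ≤ n → Connected G → Connected H →
    HullNumber (lexProduct G H) 2
mainTheorem2 m n G H 2≤m 2≤n G-connected H-connected =
  let g₁ , g₂ , g₁g₂ = edge-of-connected G 2≤m G-connected
      h₁ , h₂ , h₁h₂ = edge-of-connected H 2≤n H-connected
      seeds-distinct : (g₁ , h₁) ≢ (g₁ , h₂)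
      seeds-distinct = adj⇒≢ (lexProduct G H) (inj₂ (refl , h₁h₂))
  in  (_ , lex-edge-hullSet G H G-connected g₁g₂ h₁h₂ , refl)
    , λ _ → hullSet-length≥2 (lexProduct G H) seeds-distinct
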